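{- Let $A=\{a_1,\ldots,a_d\}$ with $d\ge2$ and $a_1<\cdots<a_d$ positive integers, and put $b_i=x^{a_i}z$. Then $$C^{A}_{peak}(x,y,z)=\cfrac{1}{1-b_d-\cfrac{1}{[b_d(1-y),\,b_{d-1},\,b_{d-1}(1-y),\,\ldots,\,b_2,\,b_2(1-y),\,b_1]}},$$ where the bracket is the continued fraction $[c_0,c_1,\ldots,c_{2d-3}]$ with $c_{2k}=b_{d-k}(1-y)$ and $c_{2k+1}=b_{d-1-k}$ for $k=0,\ldots,d-2$.
   Context: A composition with parts in $A$ is a finite sequence $\sigma=\sigma_1\cdots\sigma_m$ ($m\ge0$, empty included) of elements of $A$; $n(\sigma)$ is the sum of parts and $m(\sigma)=m$. A peak of $\sigma$ is an index $i$, $1\le i\le m-2$, with $\sigma_i<\sigma_{i+1}>\sigma_{i+2}$. $C_{peak}^A(x,y,z)=\sum_\sigma x^{n(\sigma)}y^{\#\text{peaks}(\sigma)}z^{m(\sigma)}$ over all compositions with parts in $A$. Continued fraction notation: $[c_0]=c_0$ and $[c_0,c_1,\ldots,c_n]=c_0+\frac{1}{[c_1,\ldots,c_n]}$. -}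

module Defs where

open import Data.Nat as ℕ using (ℕ; zero; suc; _∸_; _<_; _<?_; _≟_)
open import Data.Integer as ℤ using (ℤ; +_)
open import Data.List using (List; []; _∷_; _++_; map; concatMap; filter; length; upTo)
open import Data.Nat.ListAction using (sum)
open import Data.Product using (_×_; _,_)
open import Data.Bool using (if_then_else_; _∧_)
open import Relation.Nullary.Decidable using (⌊_⌋; _×-dec_)
open import Relation.Binary.PropositionalEquality using (_≡_)

peaks : List ℕ → ℕ
peaks (p ∷ q ∷ r ∷ rest) =
  (if ⌊ p <? q ⌋ ∧ ⌊ r <? q ⌋ then 1 else 0) ℕ.+ peaks (q ∷ r ∷ rest)
peaks _ = 0

words : List ℕ → ℕ → List (List ℕ)
words A zero    = [] ∷ []
words A (suc m) = concatMap (λ a → map (a ∷_) (words A m)) A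

-- Formal power series in x, y, z with integer coefficients,
-- represented by their coefficient functions: f n k m = [x^n y^k z^m] f.

Series : Set
Series = ℕ → ℕ → ℕ → ℤ

infix 4 _≋_
_≋_ : Series → Series → Set
f ≋ g = ∀ n k m → f n k m ≡ g n k m

sumℤ : List ℤ → ℤ
sumℤ []       = + 0
sumℤ (v ∷ vs) = v ℤ.+ sumℤ vs

Σ≤ : ℕ → (ℕ → ℤ) → ℤ
Σ≤ n f = sumℤ (map f (upTo (suc n)))

_⊕_ : Series → Series → Series
(f ⊕ g) n k m = f n k m ℤ.+ g n k m

⊖_ : Series → Series
(⊖ f) n k m = ℤ.- f n k m

_⊝_ : Series → Series → Series
f ⊝ g = f ⊕ (⊖ g)

_⊛_ : Series → Series → Series
(f ⊛ g) n k m =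
  Σ≤ n λ i → Σ≤ k λ j → Σ≤ m λ l → f i j l ℤ.* g (n ∸ i) (k ∸ j) (m ∸ l)

infixl 6 _⊕_ _⊝_
infixl 7 _⊛_

mono : ℕ → ℕ → ℕ → Series
mono a b c n k m = if ⌊ n ≟ a ⌋ ∧ ⌊ k ≟ b ⌋ ∧ ⌊ m ≟ c ⌋ then + 1 else + 0

𝟙 𝟘 : Series
𝟙 = mono 0 0 0
𝟘 _ _ _ = + 0

Y : Series
Y = mono 0 1 0

-- The peak generating function C^A_peak(x,y,z):
-- [x^n y^k z^m] C = #{σ composition with parts in A, n(σ)=n, m(σ)=m, #peaks = k}

Cpeak : List ℕ → Series
Cpeak A n k m =
  + length (filter (λ σ → (sum σ ≟ n) ×-dec (peaks σ ≟ k)) (words A m))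

-- Continued fractions [c₀, c₁, …, cₙ] evaluated as a fraction (numerator,
-- denominator), directly from the definition
--   [c₀] = c₀ / 1,   [c₀, c₁, …] = c₀ + 1 / [c₁, …] = (c₀ p + q) / p
-- where [c₁, …] = p / q.

cfrac : Series → List Series → Series × Series
cfrac c₀ []        = c₀ , 𝟙
cfrac c₀ (c ∷ cs) with cfrac c cs
... | p , q = c₀ ⊛ p ⊕ q , p

b : (ℕ → ℕ) → ℕ → Series
b a i = mono (a i) 0 1

cf-head : (ℕ → ℕ) → ℕ → Series
cf-head a d = b a d ⊛ (𝟙 ⊝ Y)

-- c₁, …, c_{2d-3} = b_{d-1}, b_{d-1}(1-y), …, b_2, b_2(1-y), b_1
cf-tail : (ℕ → ℕ) → ℕ → List Series
cf-tail a d =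
  concatMap (λ k → b a (d ∸ 1 ∸ k) ∷ b a (d ∸ 1 ∸ k) ⊛ (𝟙 ⊝ Y) ∷ []) (upTo (d ∸ 2))
  ++ (b a 1 ∷ [])

partList : (ℕ → ℕ) → ℕ → List ℕ
partList a d = map (λ i → a (suc i)) (upTo d)

module Submission where

-- Split every composition at its first part.  Write α i = a (suc i), B i = x^(α i) z and
-- let V j (resp. W j) be the series of compositions σ weighted by the peaks of α j σ
-- (resp. of 0 α j σ), i.e. of σ following a part α j reached by a weak descent (resp. by
-- an ascent).  The first-part decompositions form a linear system in which consecutive
-- equations differ in a single summand, giving, with S j = Σ_{i<j} B i V i,
--   V j = W j + (1 - y) S j     and     V (j+1) = V j + B (j+1) (1 - y) S (j+1).
-- Thus S (j+1) / V j satisfies S (j+2) / V (j+1) = [B (j+1), B (j+1) (1 - y), S (j+1) / V j],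
-- and C = V (d-1) = 1 + S d turns the top level into the stated continued fraction.
-- The coefficient functions of Series get their ring structure from ((ℤ⟦z⟧)⟦y⟧)⟦x⟧.

open import Defs

open import Algebra.Bundles using (CommutativeRing)
import Algebra.Construct.Pointwise as Pointwise
open import Algebra.Structures using (IsCommutativeRing)
open import Data.Bool using (true; false; if_then_else_)
open import Data.Integer as ℤ using (ℤ; +_)
import Data.Integer.Properties as ℤₚ
open import Data.List using (List; []; _∷_; _++_; map; foldr; applyUpTo; concat; concatMap; filter; length)
import Data.List.Properties as Lₚ
import Data.List.Relation.Unary.All as All
open import Data.Nat as ℕ using (ℕ; zero; suc; _≤_; _<_; z≤n; s≤s; z<s; s<s; _∸_; _≟_; _<?_)
open import Data.Nat.ListAction using (sum)
import Data.Nat.Properties as ℕₚ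
open import Data.Product using (_×_; _,_; proj₁; proj₂)
open import Data.Sum using (_⊎_; inj₁; inj₂)
open import Function using (_∘_; id; mk⇔)
open import Level using (0ℓ)
open import Relation.Binary.Definitions using (tri<; tri≈; tri>)
open import Relation.Binary.PropositionalEquality as ≡ using (_≡_; _≢_)
open import Relation.Nullary using (yes; no; contradiction)
open import Relation.Nullary.Decidable using (⌊_⌋; _×-dec_; isYes≗does; does-⇔)
open import Relation.Unary using (Pred; Decidable)

m∸[m∸n∸o]∸n≡o : ∀ m n o → o ≤ m ∸ n → m ∸ (m ∸ n ∸ o) ∸ n ≡ o
m∸[m∸n∸o]∸n≡o m n o o≤m∸n = begin
  m ∸ (m ∸ n ∸ o) ∸ n     ≡⟨ ℕₚ.∸-+-assoc m (m ∸ n ∸ o) n ⟩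
  m ∸ (m ∸ n ∸ o ℕ.+ n)   ≡⟨ ≡.cong (m ∸_) (ℕₚ.+-comm (m ∸ n ∸ o) n) ⟩
  m ∸ (n ℕ.+ (m ∸ n ∸ o)) ≡⟨ ℕₚ.∸-+-assoc m n (m ∸ n ∸ o) ⟨
  m ∸ n ∸ (m ∸ n ∸ o)     ≡⟨ ℕₚ.m∸[m∸n]≡n o≤m∸n ⟩
  o                       ∎
  where open ≡.≡-Reasoning

⌊suc≟suc⌋ : ∀ m n → ⌊ suc m ≟ suc n ⌋ ≡ ⌊ m ≟ n ⌋
⌊suc≟suc⌋ m n = ≡.trans (isYes≗does (suc m ≟ suc n))
  (≡.trans (does-⇔ (mk⇔ ℕₚ.suc-injective (≡.cong suc)) (suc m ≟ suc n) (m ≟ n)) (≡.sym (isYes≗does (m ≟ n))))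

filter-map : ∀ {A B : Set} {P : Pred B 0ℓ} (P? : Decidable P) (f : A → B) xs →
  filter P? (map f xs) ≡ map f (filter (P? ∘ f) xs)
filter-map P? f []       = ≡.refl
filter-map P? f (x ∷ xs) with P? (f x)
... | yes _ = ≡.cong (f x ∷_) (filter-map P? f xs)
... | no  _ = filter-map P? f xs

module FiniteSums (R : CommutativeRing 0ℓ 0ℓ) where

  open CommutativeRing R
  open import Relation.Binary.Reasoning.Setoid setoid
  open import Algebra.Properties.CommutativeSemigroup +-commutativeSemigroup
    using (interchange)

  ∑< : ℕ → (ℕ → Carrier) → Carrier
  ∑< zero    f = 0#
  ∑< (suc n) f = f 0 + ∑< n (f ∘ suc)

  syntax ∑< n (λ i → e) = ∑[ i < n ] e

  ∑ₗ : List Carrier → Carrier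
  ∑ₗ = foldr _+_ 0#

  ∑ₗ-applyUpTo : ∀ f n → ∑ₗ (applyUpTo f n) ≡ ∑< n f
  ∑ₗ-applyUpTo f zero    = ≡.refl
  ∑ₗ-applyUpTo f (suc n) = ≡.cong (λ s → f 0 + s) (∑ₗ-applyUpTo (f ∘ suc) n)

  ∑-cong : ∀ n {f g} → (∀ i → i < n → f i ≈ g i) → ∑< n f ≈ ∑< n g
  ∑-cong zero    f≈g = refl
  ∑-cong (suc n) f≈g = +-cong (f≈g 0 z<s) (∑-cong n (λ i i<n → f≈g (suc i) (s<s i<n)))

  ∑-zero : ∀ n {f} → (∀ i → i < n → f i ≈ 0#) → ∑< n f ≈ 0#
  ∑-zero zero    f≈0 = refl
  ∑-zero (suc n) f≈0 =
    trans (+-cong (f≈0 0 z<s) (∑-zero n (λ i i<n → f≈0 (suc i) (s<s i<n)))) (+-identityˡ 0#)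

  ∑-distrib-+ : ∀ n f g → ∑[ i < n ] (f i + g i) ≈ ∑< n f + ∑< n g
  ∑-distrib-+ zero    f g = sym (+-identityˡ 0#)
  ∑-distrib-+ (suc n) f g =
    trans (+-congˡ (∑-distrib-+ n (f ∘ suc) (g ∘ suc))) (interchange _ _ _ _)

  *-distribˡ-∑ : ∀ n c f → c * ∑< n f ≈ ∑[ i < n ] (c * f i)
  *-distribˡ-∑ zero    c f = zeroʳ c
  *-distribˡ-∑ (suc n) c f = trans (distribˡ _ _ _) (+-congˡ (*-distribˡ-∑ n c (f ∘ suc)))

  ∑-last : ∀ n f → ∑< (suc n) f ≈ ∑< n f + f n
  ∑-last zero    f = +-comm _ _
  ∑-last (suc n) f = trans (+-congˡ (∑-last n (f ∘ suc))) (sym (+-assoc _ _ _))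

  ∑-reverse : ∀ n f → ∑< n f ≈ ∑[ i < n ] f (n ∸ suc i)
  ∑-reverse zero    f = refl
  ∑-reverse (suc n) f = begin
    f 0 + ∑< n (f ∘ suc)                           ≈⟨ +-congˡ (∑-reverse n (f ∘ suc)) ⟩
    f 0 + ∑[ i < n ] f (suc (n ∸ suc i))           ≈⟨ +-comm _ _ ⟩
    ∑[ i < n ] f (suc (n ∸ suc i)) + f 0           ≈⟨ +-cong (∑-cong n shift) (reflexive (≡.cong f (≡.sym (ℕₚ.n∸n≡0 n)))) ⟩
    ∑[ i < n ] f (n ∸ i) + f (n ∸ n)               ≈⟨ ∑-last n (λ i → f (n ∸ i)) ⟨
    ∑[ i < suc n ] f (n ∸ i)                       ∎
    where
    shift : ∀ i → i < n → f (suc (n ∸ suc i)) ≈ f (n ∸ i)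
    shift i i<n = reflexive (≡.cong f (≡.sym (ℕₚ.+-∸-assoc 1 i<n)))

  ∑-triangle-suc : ∀ n (F : ℕ → ℕ → Carrier) →
    ∑[ i < suc n ] ∑[ j < suc n ∸ i ] F i j ≈ ∑[ i < n ] ∑[ j < n ∸ i ] F i j + ∑[ i < suc n ] F i (n ∸ i)
  ∑-triangle-suc n F = begin
    ∑[ i < suc n ] ∑[ j < suc n ∸ i ] F i j
      ≈⟨ ∑-cong (suc n) (λ i i≤n → row i (ℕₚ.≤-pred i≤n)) ⟩
    ∑[ i < suc n ] (∑[ j < n ∸ i ] F i j + F i (n ∸ i))
      ≈⟨ ∑-distrib-+ (suc n) (λ i → ∑< (n ∸ i) (F i)) (λ i → F i (n ∸ i)) ⟩
    ∑[ i < suc n ] ∑[ j < n ∸ i ] F i j + ∑[ i < suc n ] F i (n ∸ i)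
      ≈⟨ +-congʳ (∑-last n (λ i → ∑< (n ∸ i) (F i))) ⟩
    (∑[ i < n ] ∑[ j < n ∸ i ] F i j + ∑[ j < n ∸ n ] F n j) + ∑[ i < suc n ] F i (n ∸ i)
      ≈⟨ +-congʳ (+-congˡ (reflexive (≡.cong (λ k → ∑< k (F n)) (ℕₚ.n∸n≡0 n)))) ⟩
    (∑[ i < n ] ∑[ j < n ∸ i ] F i j + 0#) + ∑[ i < suc n ] F i (n ∸ i)
      ≈⟨ +-congʳ (+-identityʳ _) ⟩
    ∑[ i < n ] ∑[ j < n ∸ i ] F i j + ∑[ i < suc n ] F i (n ∸ i)
      ∎
    where
    row : ∀ i → i ≤ n → ∑[ j < suc n ∸ i ] F i j ≈ ∑[ j < n ∸ i ] F i j + F i (n ∸ i)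
    row i i≤n = trans (reflexive (≡.cong (λ k → ∑< k (F i)) (ℕₚ.+-∸-assoc 1 i≤n))) (∑-last (n ∸ i) (F i))

  ∑-triangle-swap : ∀ n (F : ℕ → ℕ → Carrier) → ∑[ i < n ] ∑[ j < n ∸ i ] F i j ≈ ∑[ i < n ] ∑[ j < n ∸ i ] F j i
  ∑-triangle-swap zero    F = refl
  ∑-triangle-swap (suc n) F = begin
    ∑[ i < suc n ] ∑[ j < suc n ∸ i ] F i j                              ≈⟨ ∑-triangle-suc n F ⟩
    ∑[ i < n ] ∑[ j < n ∸ i ] F i j + ∑[ i < suc n ] F i (n ∸ i)         ≈⟨ +-cong (∑-triangle-swap n F) antidiagonal ⟩
    ∑[ i < n ] ∑[ j < n ∸ i ] F j i + ∑[ i < suc n ] F (n ∸ i) i         ≈⟨ ∑-triangle-suc n (λ i j → F j i) ⟨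
    ∑[ i < suc n ] ∑[ j < suc n ∸ i ] F j i                              ∎
    where
    antidiagonal : ∑[ i < suc n ] F i (n ∸ i) ≈ ∑[ i < suc n ] F (n ∸ i) i
    antidiagonal = trans (∑-reverse (suc n) (λ i → F i (n ∸ i)))
      (∑-cong (suc n) (λ i i≤n → reflexive (≡.cong (F (n ∸ i)) (ℕₚ.m∸[m∸n]≡n (ℕₚ.≤-pred i≤n)))))

  ∑-triangle-swap-≤ : ∀ n (F : ℕ → ℕ → Carrier) →
    ∑[ i < suc n ] ∑[ j < suc (n ∸ i) ] F i j ≈ ∑[ i < suc n ] ∑[ j < suc (n ∸ i) ] F j i
  ∑-triangle-swap-≤ n F =
    trans (closed F) (trans (∑-triangle-swap (suc n) F) (sym (closed (λ i j → F j i))))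
    where
    closed : ∀ G → ∑[ i < suc n ] ∑[ j < suc (n ∸ i) ] G i j ≈ ∑[ i < suc n ] ∑[ j < suc n ∸ i ] G i j
    closed G = ∑-cong (suc n) {λ i → ∑< (suc (n ∸ i)) (G i)} {λ i → ∑< (suc n ∸ i) (G i)} (λ i i≤n →
      reflexive (≡.cong (λ k → ∑< k (G i)) (≡.sym (ℕₚ.+-∸-assoc 1 (ℕₚ.≤-pred i≤n)))))

  ∑-differs-at : ∀ N j f g Δ → j < N → (∀ i → i < N → i ≢ j → f i ≈ g i) → f j ≈ g j + Δ →
    ∑< N f ≈ ∑< N g + Δ
  ∑-differs-at (suc N) zero    f g Δ _ f≈g fj≈ = begin
    f 0 + ∑< N (f ∘ suc)        ≈⟨ +-cong fj≈ (∑-cong N (λ i i<N → f≈g (suc i) (s<s i<N) (λ ()))) ⟩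
    (g 0 + Δ) + ∑< N (g ∘ suc)  ≈⟨ +-assoc _ _ _ ⟩
    g 0 + (Δ + ∑< N (g ∘ suc))  ≈⟨ +-congˡ (+-comm _ _) ⟩
    g 0 + (∑< N (g ∘ suc) + Δ)  ≈⟨ +-assoc _ _ _ ⟨
    ∑< (suc N) g + Δ            ∎
  ∑-differs-at (suc N) (suc j) f g Δ (s<s j<N) f≈g fj≈ = begin
    f 0 + ∑< N (f ∘ suc)        ≈⟨ +-cong (f≈g 0 z<s (λ ())) (∑-differs-at N j (f ∘ suc) (g ∘ suc) Δ j<N
                                     (λ i i<N i≢j → f≈g (suc i) (s<s i<N) (i≢j ∘ ℕₚ.suc-injective)) fj≈) ⟩
    g 0 + (∑< N (g ∘ suc) + Δ)  ≈⟨ +-assoc _ _ _ ⟨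
    ∑< (suc N) g + Δ            ∎

  ∑-differs-below : ∀ N j f g h → j ≤ N → (∀ i → i < j → f i ≈ g i + h i) → (∀ i → i < N → j ≤ i → f i ≈ g i) →
    ∑< N f ≈ ∑< N g + ∑< j h
  ∑-differs-below N zero f g h _ _ f≈g = trans (∑-cong N (λ i i<N → f≈g i i<N z≤n)) (sym (+-identityʳ _))
  ∑-differs-below (suc N) (suc j) f g h (s≤s j≤N) f≈g+h f≈g = begin
    f 0 + ∑< N (f ∘ suc)
      ≈⟨ +-cong (f≈g+h 0 z<s) (∑-differs-below N j (f ∘ suc) (g ∘ suc) (h ∘ suc) j≤N
           (λ i i<j → f≈g+h (suc i) (s<s i<j)) (λ i i<N j≤i → f≈g (suc i) (s<s i<N) (s≤s j≤i))) ⟩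
    (g 0 + h 0) + (∑< N (g ∘ suc) + ∑< j (h ∘ suc))
      ≈⟨ interchange _ _ _ _ ⟩
    ∑< (suc N) g + ∑< (suc j) h
      ∎

module PowerSeries (R : CommutativeRing 0ℓ 0ℓ) where

  open CommutativeRing R hiding (isCommutativeRing)
  open FiniteSums R
  open import Relation.Binary.Reasoning.Setoid setoid

  infixl 7 _⋆_

  _⋆_ : (ℕ → Carrier) → (ℕ → Carrier) → ℕ → Carrier
  (f ⋆ g) n = ∑[ i < suc n ] (f i * g (n ∸ i))

  unit : ℕ → Carrier
  unit zero    = 1#
  unit (suc _) = 0#

  infix 4 _≐_

  private
    _≐_ : (ℕ → Carrier) → (ℕ → Carrier) → Set
    f ≐ g = ∀ n → f n ≈ g n

  ⋆-cong : ∀ {f f′ g g′} → f ≐ f′ → g ≐ g′ → f ⋆ g ≐ f′ ⋆ g′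
  ⋆-cong f≐f′ g≐g′ n = ∑-cong (suc n) (λ i _ → *-cong (f≐f′ i) (g≐g′ (n ∸ i)))

  ⋆-comm : ∀ f g → f ⋆ g ≐ g ⋆ f
  ⋆-comm f g n = trans (∑-reverse (suc n) (λ i → f i * g (n ∸ i))) (∑-cong (suc n) swap)
    where
    swap : ∀ i → i < suc n → f (n ∸ i) * g (n ∸ (n ∸ i)) ≈ g i * f (n ∸ i)
    swap i i≤n = trans (*-comm _ _) (*-congʳ (reflexive (≡.cong g (ℕₚ.m∸[m∸n]≡n (ℕₚ.≤-pred i≤n)))))

  ⋆-assoc : ∀ f g h → (f ⋆ g) ⋆ h ≐ f ⋆ (g ⋆ h)
  ⋆-assoc f g h n = begin
    ((f ⋆ g) ⋆ h) n
      ≈⟨ ⋆-comm (f ⋆ g) h n ⟩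
    ∑[ i < suc n ] (h i * ∑[ j < suc (n ∸ i) ] (f j * g (n ∸ i ∸ j)))
      ≈⟨ ∑-cong (suc n) (λ i _ → *-distribˡ-∑ (suc (n ∸ i)) (h i) (λ j → f j * g (n ∸ i ∸ j))) ⟩
    ∑[ i < suc n ] ∑[ j < suc (n ∸ i) ] (h i * (f j * g (n ∸ i ∸ j)))
      ≈⟨ ∑-triangle-swap-≤ n (λ i j → h i * (f j * g (n ∸ i ∸ j))) ⟩
    ∑[ i < suc n ] ∑[ j < suc (n ∸ i) ] (h j * (f i * g (n ∸ j ∸ i)))
      ≈⟨ ∑-cong (suc n) (λ i _ → ∑-reverse (suc (n ∸ i)) (λ j → h j * (f i * g (n ∸ j ∸ i)))) ⟩
    ∑[ i < suc n ] ∑[ j < suc (n ∸ i) ] (h (n ∸ i ∸ j) * (f i * g (n ∸ (n ∸ i ∸ j) ∸ i)))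
      ≈⟨ ∑-cong (suc n) (λ i i≤n → ∑-cong (suc (n ∸ i)) (λ j j≤ → term i j (ℕₚ.≤-pred j≤))) ⟩
    ∑[ i < suc n ] ∑[ j < suc (n ∸ i) ] (f i * (g j * h (n ∸ i ∸ j)))
      ≈⟨ ∑-cong (suc n) (λ i _ → *-distribˡ-∑ (suc (n ∸ i)) (f i) (λ j → g j * h (n ∸ i ∸ j))) ⟨
    (f ⋆ (g ⋆ h)) n
      ∎
    where
    term : ∀ i j → j ≤ n ∸ i →
      h (n ∸ i ∸ j) * (f i * g (n ∸ (n ∸ i ∸ j) ∸ i)) ≈ f i * (g j * h (n ∸ i ∸ j))
    term i j j≤n-i = begin
      h (n ∸ i ∸ j) * (f i * g (n ∸ (n ∸ i ∸ j) ∸ i)) ≈⟨ *-congˡ (*-congˡ (reflexive (≡.cong g (m∸[m∸n∸o]∸n≡o n i j j≤n-i)))) ⟩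
      h (n ∸ i ∸ j) * (f i * g j)                     ≈⟨ *-comm _ _ ⟩
      (f i * g j) * h (n ∸ i ∸ j)                     ≈⟨ *-assoc _ _ _ ⟩
      f i * (g j * h (n ∸ i ∸ j))                     ∎

  ⋆-identityˡ : ∀ f → unit ⋆ f ≐ f
  ⋆-identityˡ f n =
    trans (+-cong (*-identityˡ _) (∑-zero n (λ i _ → zeroˡ (f (n ∸ suc i))))) (+-identityʳ _)

  ⋆-distribˡ : ∀ f g h → f ⋆ (λ n → g n + h n) ≐ λ n → (f ⋆ g) n + (f ⋆ h) n
  ⋆-distribˡ f g h n =
    trans (∑-cong (suc n) (λ i _ → distribˡ (f i) (g (n ∸ i)) (h (n ∸ i))))
      (∑-distrib-+ (suc n) (λ i → f i * g (n ∸ i)) (λ i → f i * h (n ∸ i)))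

  isCommutativeRing : IsCommutativeRing _≐_ (λ f g n → f n + g n) _⋆_ (λ f n → - f n) (λ _ → 0#) unit
  isCommutativeRing = record
    { isRing = record
      { +-isAbelianGroup = Pointwise.isAbelianGroup ℕ +-isAbelianGroup
      ; *-cong           = ⋆-cong
      ; *-assoc          = ⋆-assoc
      ; *-identity       = ⋆-identityˡ , λ f n → trans (⋆-comm f unit n) (⋆-identityˡ f n)
      ; distrib          = ⋆-distribˡ , λ f g h n →
          trans (⋆-comm (λ n → g n + h n) f n) (trans (⋆-distribˡ f g h n) (+-cong (⋆-comm f g n) (⋆-comm f h n)))
      }
    ; *-comm = ⋆-comm
    }

  commutativeRing : CommutativeRing 0ℓ 0ℓ
  commutativeRing = record { isCommutativeRing = isCommutativeRing }

  ∑-coefficient : ∀ N F n → FiniteSums.∑< commutativeRing N F n ≡ ∑[ i < N ] F i n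
  ∑-coefficient zero    F n = ≡.refl
  ∑-coefficient (suc N) F n = ≡.cong (λ s → F 0 n + s) (∑-coefficient N (F ∘ suc) n)

  monomial : ℕ → Carrier → ℕ → Carrier
  monomial zero    x zero    = x
  monomial zero    x (suc n) = 0#
  monomial (suc a) x zero    = 0#
  monomial (suc a) x (suc n) = monomial a x n

  monomial-if : ∀ a x n → monomial a x n ≡ (if ⌊ n ≟ a ⌋ then x else 0#)
  monomial-if zero    x zero    = ≡.refl
  monomial-if zero    x (suc n) = ≡.refl
  monomial-if (suc a) x zero    = ≡.refl
  monomial-if (suc a) x (suc n) = ≡.trans (monomial-if a x n)
    (≡.cong (if_then x else 0#) (≡.sym (⌊suc≟suc⌋ n a)))

  private
    ∑-monomial-in : ∀ N a x (G : ℕ → Carrier) → a < N → ∑[ i < N ] (monomial a x i * G i) ≈ x * G a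
    ∑-monomial-in (suc N) zero    x G _ =
      trans (+-congˡ (∑-zero N (λ i _ → zeroˡ (G (suc i))))) (+-identityʳ _)
    ∑-monomial-in (suc N) (suc a) x G (s<s a<N) =
      trans (+-cong (zeroˡ (G 0)) (∑-monomial-in N a x (G ∘ suc) a<N)) (+-identityˡ _)

    ∑-monomial-out : ∀ N a x (G : ℕ → Carrier) → N ≤ a → ∑[ i < N ] (monomial a x i * G i) ≈ 0#
    ∑-monomial-out zero    a       x G _         = refl
    ∑-monomial-out (suc N) (suc a) x G (s≤s N≤a) =
      trans (+-cong (zeroˡ (G 0)) (∑-monomial-out N a x (G ∘ suc) N≤a)) (+-identityˡ _)

  monomial-⋆ : ∀ a x g n → a ≤ n → (monomial a x ⋆ g) n ≈ x * g (n ∸ a)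
  monomial-⋆ a x g n a≤n = ∑-monomial-in (suc n) a x (λ i → g (n ∸ i)) (s≤s a≤n)

  monomial-⋆-below : ∀ a x g n → n < a → (monomial a x ⋆ g) n ≈ 0#
  monomial-⋆-below a x g n n<a = ∑-monomial-out (suc n) a x (λ i → g (n ∸ i)) n<a

module _ (R : CommutativeRing 0ℓ 0ℓ) where

  open CommutativeRing R

  isCommutativeRing-replace-* : (_∙_ : Carrier → Carrier → Carrier) (e : Carrier) →
    (∀ x y → x ∙ y ≈ x * y) → e ≈ 1# → IsCommutativeRing _≈_ _+_ _∙_ -_ 0# e
  isCommutativeRing-replace-* _∙_ e ∙≈* e≈1 = record
    { isRing = record
      { +-isAbelianGroup = +-isAbelianGroup
      ; *-cong     = λ {x} {x′} {y} {y′} x≈x′ y≈y′ →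
          trans (∙≈* x y) (trans (*-cong x≈x′ y≈y′) (sym (∙≈* x′ y′)))
      ; *-assoc    = λ x y z → trans (∙≈* _ z) (trans (*-congʳ (∙≈* x y))
          (trans (*-assoc x y z) (sym (trans (∙≈* x _) (*-congˡ (∙≈* y z))))))
      ; *-identity = (λ x → trans (∙≈* e x) (trans (*-congʳ e≈1) (*-identityˡ x)))
                   , (λ x → trans (∙≈* x e) (trans (*-congˡ e≈1) (*-identityʳ x)))
      ; distrib    = (λ x y z → trans (∙≈* x _) (trans (distribˡ x y z) (sym (+-cong (∙≈* x y) (∙≈* x z)))))
                   , (λ x y z → trans (∙≈* _ x) (trans (distribʳ x y z) (sym (+-cong (∙≈* y x) (∙≈* z x)))))
      }
    ; *-comm = λ x y → trans (∙≈* x y) (trans (*-comm x y) (sym (∙≈* y x)))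
    }

module ContinuedFractions (R : CommutativeRing 0ℓ 0ℓ) where

  open CommutativeRing R hiding (zero)
  open FiniteSums R
  open import Algebra.Properties.Ring ring using (+-cancelʳ; //-rightDividesˡ)
  open import Algebra.Solver.Ring.NaturalCoefficients.Default commutativeSemiring
  open import Relation.Binary.Reasoning.Setoid setoid

  fraction : Carrier → List Carrier → Carrier × Carrier
  fraction c₀ []       = c₀ , 1#
  fraction c₀ (c ∷ cs) = c₀ * proj₁ (fraction c cs) + proj₂ (fraction c cs) , proj₁ (fraction c cs)

  module Convergents (B V : ℕ → Carrier) (u : Carrier) where

    S : ℕ → Carrier
    S j = ∑[ i < j ] (B i * V i)

    quotients : ℕ → List Carrier
    quotients zero    = []
    quotients (suc j) = B (suc j) * u ∷ B j ∷ quotients j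

    Recurrence : ℕ → Set
    Recurrence j = V (suc j) ≈ V j + B (suc j) * (u * S (suc j))

    S-fraction : ∀ j → (∀ i → i < j → Recurrence i) →
      S (suc j) * proj₂ (fraction (B j) (quotients j)) ≈ V j * proj₁ (fraction (B j) (quotients j))
    S-fraction zero    _   = solve 2 (λ b v → (b :* v :+ con 0) :* con 1 := v :* b) refl (B 0) (V 0)
    S-fraction (suc j) rec = begin
      S (suc (suc j)) * P                            ≈⟨ *-congʳ (∑-last (suc j) (λ i → B i * V i)) ⟩
      (S (suc j) + B′ * V′) * P                      ≈⟨ expand (S (suc j)) B′ u p q V′ ⟩
      (B′ * u) * p * S (suc j) + S (suc j) * q + B′ * V′ * P
        ≈⟨ +-congʳ (+-congˡ (S-fraction j (λ i i<j → rec i (ℕₚ.m<n⇒m<1+n i<j)))) ⟩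
      (B′ * u) * p * S (suc j) + V j * p + B′ * V′ * P  ≈⟨ +-congʳ (collect B′ u p (S (suc j)) (V j)) ⟩
      (V j + B′ * (u * S (suc j))) * p + B′ * V′ * P    ≈⟨ +-congʳ (*-congʳ (sym (rec j ℕₚ.≤-refl))) ⟩
      V′ * p + B′ * V′ * P                           ≈⟨ factor V′ p B′ P ⟩
      V′ * (B′ * P + p)                              ∎
      where
      p = proj₁ (fraction (B j) (quotients j))
      q = proj₂ (fraction (B j) (quotients j))
      B′ = B (suc j)
      V′ = V (suc j)
      P = B′ * u * p + q
      expand : ∀ s b u p q v → (s + b * v) * (b * u * p + q) ≈ (b * u) * p * s + s * q + b * v * (b * u * p + q)
      expand = solve 6 (λ s b u p q v → (s :+ b :* v) :* (b :* u :* p :+ q)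
                                     := (b :* u) :* p :* s :+ s :* q :+ b :* v :* (b :* u :* p :+ q)) refl
      collect : ∀ b u p s v → (b * u) * p * s + v * p ≈ (v + b * (u * s)) * p
      collect = solve 5 (λ b u p s v → (b :* u) :* p :* s :+ v :* p := (v :+ b :* (u :* s)) :* p) refl
      factor : ∀ v p b P → v * p + b * v * P ≈ v * (b * P + p)
      factor = solve 4 (λ v p b P → v :* p :+ b :* v :* P := v :* (b :* P :+ p)) refl

    fraction-identity : ∀ e C → (∀ i → i < suc e → Recurrence i) → C ≈ V (suc e) → C ≈ 1# + S (suc (suc e)) →
      let P = proj₁ (fraction (B (suc e) * u) (B e ∷ quotients e))
          Q = proj₂ (fraction (B (suc e) * u) (B e ∷ quotients e))
      in ((1# - B (suc e)) * P - Q) * C ≈ P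
    fraction-identity e C rec C≈V C≈1+S = +-cancelʳ (C * (B′ * P + Q)) _ P (begin
      ((1# - B′) * P - Q) * C + C * (B′ * P + Q)   ≈⟨ regroup ((1# - B′) * P - Q) Q B′ P C ⟩
      ((1# - B′) * P - Q + Q) * C + B′ * (P * C)   ≈⟨ +-congʳ (*-congʳ (//-rightDividesˡ Q ((1# - B′) * P))) ⟩
      (1# - B′) * P * C + B′ * (P * C)             ≈⟨ regroup′ (1# - B′) B′ P C ⟩
      ((1# - B′) + B′) * (P * C)                   ≈⟨ *-congʳ (//-rightDividesˡ B′ 1#) ⟩
      1# * (P * C)                                 ≈⟨ *-identityˡ (P * C) ⟩
      P * C                                        ≈⟨ *-congˡ C≈1+S ⟩
      P * (1# + S (suc (suc e)))                   ≈⟨ distribˡ P 1# _ ⟩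
      P * 1# + P * S (suc (suc e))                 ≈⟨ +-cong (*-identityʳ P) (*-comm P _) ⟩
      P + S (suc (suc e)) * P                      ≈⟨ +-congˡ (S-fraction (suc e) rec) ⟩
      P + V (suc e) * (B′ * P + Q)                 ≈⟨ +-congˡ (*-congʳ (sym C≈V)) ⟩
      P + C * (B′ * P + Q)                         ∎)
      where
      B′ = B (suc e)
      P = proj₁ (fraction (B′ * u) (B e ∷ quotients e))
      Q = proj₂ (fraction (B′ * u) (B e ∷ quotients e))
      regroup : ∀ x q b p c → x * c + c * (b * p + q) ≈ (x + q) * c + b * (p * c)
      regroup = solve 5 (λ x q b p c → x :* c :+ c :* (b :* p :+ q) := (x :+ q) :* c :+ b :* (p :* c)) refl
      regroup′ : ∀ w b p c → w * p * c + b * (p * c) ≈ (w + b) * (p * c)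
      regroup′ = solve 4 (λ w b p c → w :* p :* c :+ b :* (p :* c) := (w :+ b) :* (p :* c)) refl

module PeakSystems (R : CommutativeRing 0ℓ 0ℓ) where

  open CommutativeRing R hiding (zero)
  open FiniteSums R
  open ContinuedFractions R using (module Convergents)
  open import Algebra.Properties.Ring ring using (//-rightDividesˡ)
  open import Algebra.Solver.Ring.NaturalCoefficients.Default commutativeSemiring
  open import Relation.Binary.Reasoning.Setoid setoid

  -- In the application X j i and G j i weigh σ by the peaks of α j α i σ and of 0 α j α i σ.
  record IsPeakSystem (d : ℕ) (B V W : ℕ → Carrier) (X G : ℕ → ℕ → Carrier) (y C : Carrier) : Set where
    field
      C-first-part : C ≈ 1# + ∑[ i < d ] (B i * V i)
      V-first-part : ∀ j → V j ≈ 1# + ∑[ i < d ] (B i * X j i)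
      W-first-part : ∀ j → W j ≈ 1# + ∑[ i < d ] (B i * G j i)
      X-descent    : ∀ {i j} → i ≤ j → j < d → X j i ≈ V i
      X-ascent     : ∀ {i j} → j < i → i < d → X j i ≈ W i
      G-peak       : ∀ {i j} → i < j → j < d → G j i ≈ y * V i
      G-rise       : ∀ {i j} → j ≤ i → i < d → G j i ≈ X j i

  module _ {d B V W X G y C} (system : IsPeakSystem d B V W X G y C) where

    open IsPeakSystem system
    open Convergents B V (1# - y) using (S; Recurrence)

    private
      split-by-y : ∀ c x → c * x ≈ c * (y * x) + (1# - y) * (c * x)
      split-by-y c x = begin
        c * x                                ≈⟨ *-identityˡ (c * x) ⟨
        1# * (c * x)                         ≈⟨ *-congʳ (//-rightDividesˡ y 1#) ⟨
        ((1# - y) + y) * (c * x)             ≈⟨ solve 4 (λ c x y u → (u :+ y) :* (c :* x) := c :* (y :* x) :+ u :* (c :* x))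
                                                  refl c x y (1# - y) ⟩
        c * (y * x) + (1# - y) * (c * x)     ∎

    V≈W+[1-y]S : ∀ j → j < d → V j ≈ W j + (1# - y) * S j
    V≈W+[1-y]S j j<d = begin
      V j                                                   ≈⟨ V-first-part j ⟩
      1# + ∑[ i < d ] (B i * X j i)                         ≈⟨ +-congˡ (∑-differs-below d j _ _ _ (ℕₚ.<⇒≤ j<d) before after) ⟩
      1# + (∑[ i < d ] (B i * G j i) + ∑[ i < j ] ((1# - y) * (B i * V i)))
                                                            ≈⟨ +-assoc _ _ _ ⟨
      (1# + ∑[ i < d ] (B i * G j i)) + ∑[ i < j ] ((1# - y) * (B i * V i))
                                                            ≈⟨ +-cong (W-first-part j) (*-distribˡ-∑ j (1# - y) _) ⟨
      W j + (1# - y) * S j                                  ∎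
      where
      before : ∀ i → i < j → B i * X j i ≈ B i * G j i + (1# - y) * (B i * V i)
      before i i<j = begin
        B i * X j i                               ≈⟨ *-congˡ (X-descent (ℕₚ.<⇒≤ i<j) j<d) ⟩
        B i * V i                                 ≈⟨ split-by-y (B i) (V i) ⟩
        B i * (y * V i) + (1# - y) * (B i * V i)  ≈⟨ +-congʳ (*-congˡ (G-peak i<j j<d)) ⟨
        B i * G j i + (1# - y) * (B i * V i)      ∎
      after : ∀ i → i < d → j ≤ i → B i * X j i ≈ B i * G j i
      after i i<d j≤i = *-congˡ (sym (G-rise j≤i i<d))

    V-step : ∀ j → suc j < d → Recurrence j
    V-step j 1+j<d = begin
      V (suc j)                               ≈⟨ V-first-part (suc j) ⟩
      1# + ∑[ i < d ] (B i * X (suc j) i)     ≈⟨ +-congˡ (∑-differs-at d (suc j) _ _ _ 1+j<d same differ) ⟩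
      1# + (∑[ i < d ] (B i * X j i) + Δ)     ≈⟨ +-assoc _ _ _ ⟨
      (1# + ∑[ i < d ] (B i * X j i)) + Δ     ≈⟨ +-congʳ (V-first-part j) ⟨
      V j + Δ                                 ∎
      where
      j<d = ℕₚ.<-trans (ℕₚ.n<1+n j) 1+j<d
      Δ = B (suc j) * ((1# - y) * S (suc j))
      same : ∀ i → i < d → i ≢ suc j → B i * X (suc j) i ≈ B i * X j i
      same i i<d i≢1+j with ℕₚ.<-cmp i (suc j)
      ... | tri< i<1+j _ _ = *-congˡ (trans (X-descent (ℕₚ.<⇒≤ i<1+j) 1+j<d) (sym (X-descent (ℕₚ.≤-pred i<1+j) j<d)))
      ... | tri≈ _ i≡1+j _ = contradiction i≡1+j i≢1+j
      ... | tri> _ _ 1+j<i = *-congˡ (trans (X-ascent 1+j<i i<d) (sym (X-ascent (ℕₚ.<-trans (ℕₚ.n<1+n j) 1+j<i) i<d)))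
      differ : B (suc j) * X (suc j) (suc j) ≈ B (suc j) * X j (suc j) + Δ
      differ = begin
        B (suc j) * X (suc j) (suc j)                  ≈⟨ *-congˡ (X-descent ℕₚ.≤-refl 1+j<d) ⟩
        B (suc j) * V (suc j)                          ≈⟨ *-congˡ (V≈W+[1-y]S (suc j) 1+j<d) ⟩
        B (suc j) * (W (suc j) + (1# - y) * S (suc j)) ≈⟨ distribˡ _ _ _ ⟩
        B (suc j) * W (suc j) + Δ                      ≈⟨ +-congʳ (*-congˡ (X-ascent (ℕₚ.n<1+n j) 1+j<d)) ⟨
        B (suc j) * X j (suc j) + Δ                    ∎

    C≈V : ∀ {e} → d ≡ suc e → C ≈ V e
    C≈V {e} ≡.refl = begin
      C                              ≈⟨ C-first-part ⟩
      1# + S d                       ≈⟨ +-congˡ (∑-cong d (λ i i<d → *-congˡ {B i} (X-descent (ℕₚ.≤-pred i<d) (ℕₚ.n<1+n e)))) ⟨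
      1# + ∑[ i < d ] (B i * X e i)  ≈⟨ V-first-part e ⟨
      V e                            ∎

module ℤ⟦z⟧ = PowerSeries ℤₚ.+-*-commutativeRing
module ℤ⟦y,z⟧ = PowerSeries ℤ⟦z⟧.commutativeRing
module ℤ⟦x,y,z⟧ = PowerSeries ℤ⟦y,z⟧.commutativeRing

module _ where

  open FiniteSums ℤₚ.+-*-commutativeRing using (∑<; ∑-cong)

  private

    sumℤ-applyUpTo : ∀ f n → sumℤ (applyUpTo f n) ≡ ∑< n f
    sumℤ-applyUpTo f zero    = ≡.refl
    sumℤ-applyUpTo f (suc n) = ≡.cong (λ s → f 0 ℤ.+ s) (sumℤ-applyUpTo (f ∘ suc) n)

    Σ≤-∑ : ∀ n f → Σ≤ n f ≡ ∑[ i < suc n ] f i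
    Σ≤-∑ n f = ≡.trans (≡.cong sumℤ (Lₚ.map-applyUpTo id f (suc n))) (sumℤ-applyUpTo f (suc n))

  ⊛-coefficient : ∀ f g n k m → (f ⊛ g) n k m ≡ (f ℤ⟦x,y,z⟧.⋆ g) n k m
  ⊛-coefficient f g n k m = begin
    (f ⊛ g) n k m
      ≡⟨ Σ≤-∑ n (λ i → Σ≤ k (λ j → Σ≤ m (term i j))) ⟩
    ∑[ i < suc n ] Σ≤ k (λ j → Σ≤ m (λ l → term i j l))
      ≡⟨ ∑-cong (suc n) (λ i _ → ≡.trans (Σ≤-∑ k (λ j → Σ≤ m (term i j)))
           (∑-cong (suc k) (λ j _ → Σ≤-∑ m (term i j)))) ⟩
    ∑[ i < suc n ] ∑[ j < suc k ] ∑[ l < suc m ] term i j l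
      ≡⟨ ∑-cong (suc n) (λ i _ → ℤ⟦z⟧.∑-coefficient (suc k) (λ j → f i j ℤ⟦z⟧.⋆ g (n ∸ i) (k ∸ j)) m) ⟨
    ∑[ i < suc n ] (f i ℤ⟦y,z⟧.⋆ g (n ∸ i)) k m
      ≡⟨ ℤ⟦z⟧.∑-coefficient (suc n) (λ i → (f i ℤ⟦y,z⟧.⋆ g (n ∸ i)) k) m ⟨
    FiniteSums.∑< ℤ⟦z⟧.commutativeRing (suc n) (λ i → (f i ℤ⟦y,z⟧.⋆ g (n ∸ i)) k) m
      ≡⟨ ≡.cong-app (ℤ⟦y,z⟧.∑-coefficient (suc n) (λ i → f i ℤ⟦y,z⟧.⋆ g (n ∸ i)) k) m ⟨
    (f ℤ⟦x,y,z⟧.⋆ g) n k m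
      ∎
    where
    open ≡.≡-Reasoning
    term : ℕ → ℕ → ℕ → ℤ
    term i j l = f i j l ℤ.* g (n ∸ i) (k ∸ j) (m ∸ l)

𝟙-coefficient : ∀ n k m → 𝟙 n k m ≡ ℤ⟦x,y,z⟧.unit n k m
𝟙-coefficient zero    zero    zero    = ≡.refl
𝟙-coefficient zero    zero    (suc m) = ≡.refl
𝟙-coefficient zero    (suc k) m       = ≡.refl
𝟙-coefficient (suc n) k       m       = ≡.refl

seriesRing : CommutativeRing 0ℓ 0ℓ
seriesRing = record
  { isCommutativeRing = isCommutativeRing-replace-* ℤ⟦x,y,z⟧.commutativeRing _⊛_ 𝟙 ⊛-coefficient 𝟙-coefficient }

monomial³ : ℕ → ℕ → ℕ → Series
monomial³ a b c = ℤ⟦x,y,z⟧.monomial a (ℤ⟦y,z⟧.monomial b (ℤ⟦z⟧.monomial c (+ 1)))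

mono-monomial³ : ∀ a b c n k m → mono a b c n k m ≡ monomial³ a b c n k m
mono-monomial³ a b c n k m
  rewrite ℤ⟦x,y,z⟧.monomial-if a (ℤ⟦y,z⟧.monomial b (ℤ⟦z⟧.monomial c (+ 1))) n
  with ⌊ n ≟ a ⌋
... | false = ≡.refl
... | true rewrite ℤ⟦y,z⟧.monomial-if b (ℤ⟦z⟧.monomial c (+ 1)) k with ⌊ k ≟ b ⌋
...   | false = ≡.refl
...   | true rewrite ℤ⟦z⟧.monomial-if c (+ 1) m with ⌊ m ≟ c ⌋
...     | false = ≡.refl
...     | true  = ≡.refl

private
  mono-⊛-monomial³ : ∀ a b c F n k m → (mono a b c ⊛ F) n k m ≡ (monomial³ a b c ℤ⟦x,y,z⟧.⋆ F) n k m
  mono-⊛-monomial³ a b c F n k m = ≡.trans (⊛-coefficient (mono a b c) F n k m)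
    (ℤ⟦x,y,z⟧.⋆-cong {mono a b c} {monomial³ a b c} {F} {F} (mono-monomial³ a b c) (λ _ _ _ → ≡.refl) n k m)

mono-⊛ : ∀ a b c F n k m → a ≤ n → b ≤ k → c ≤ m → (mono a b c ⊛ F) n k m ≡ F (n ∸ a) (k ∸ b) (m ∸ c)
mono-⊛ a b c F n k m a≤n b≤k c≤m = begin
  (mono a b c ⊛ F) n k m
    ≡⟨ mono-⊛-monomial³ a b c F n k m ⟩
  (monomial³ a b c ℤ⟦x,y,z⟧.⋆ F) n k m
    ≡⟨ ℤ⟦x,y,z⟧.monomial-⋆ a _ F n a≤n k m ⟩
  (ℤ⟦y,z⟧.monomial b (ℤ⟦z⟧.monomial c (+ 1)) ℤ⟦y,z⟧.⋆ F (n ∸ a)) k m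
    ≡⟨ ℤ⟦y,z⟧.monomial-⋆ b _ (F (n ∸ a)) k b≤k m ⟩
  (ℤ⟦z⟧.monomial c (+ 1) ℤ⟦z⟧.⋆ F (n ∸ a) (k ∸ b)) m
    ≡⟨ ℤ⟦z⟧.monomial-⋆ c (+ 1) (F (n ∸ a) (k ∸ b)) m c≤m ⟩
  + 1 ℤ.* F (n ∸ a) (k ∸ b) (m ∸ c)
    ≡⟨ ℤₚ.*-identityˡ _ ⟩
  F (n ∸ a) (k ∸ b) (m ∸ c)
    ∎
  where open ≡.≡-Reasoning

mono-⊛-below : ∀ a b c F n k m → n < a ⊎ k < b ⊎ m < c → (mono a b c ⊛ F) n k m ≡ + 0
mono-⊛-below a b c F n k m below = ≡.trans (mono-⊛-monomial³ a b c F n k m) (vanish below)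
  where
  vanish : n < a ⊎ k < b ⊎ m < c → (monomial³ a b c ℤ⟦x,y,z⟧.⋆ F) n k m ≡ + 0
  vanish (inj₁ n<a) = ℤ⟦x,y,z⟧.monomial-⋆-below a _ F n n<a k m
  vanish (inj₂ k<b⊎m<c) with a ℕ.≤? n
  ... | no a≰n  = vanish (inj₁ (ℕₚ.≰⇒> a≰n))
  ... | yes a≤n = ≡.trans (ℤ⟦x,y,z⟧.monomial-⋆ a _ F n a≤n k m) (vanish-y k<b⊎m<c)
    where
    vanish-y : k < b ⊎ m < c → (ℤ⟦y,z⟧.monomial b (ℤ⟦z⟧.monomial c (+ 1)) ℤ⟦y,z⟧.⋆ F (n ∸ a)) k m ≡ + 0
    vanish-y (inj₁ k<b) = ℤ⟦y,z⟧.monomial-⋆-below b _ (F (n ∸ a)) k k<b m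
    vanish-y (inj₂ m<c) with b ℕ.≤? k
    ... | no b≰k  = vanish-y (inj₁ (ℕₚ.≰⇒> b≰k))
    ... | yes b≤k = ≡.trans (ℤ⟦y,z⟧.monomial-⋆ b _ (F (n ∸ a)) k b≤k m)
                            (ℤ⟦z⟧.monomial-⋆-below c (+ 1) (F (n ∸ a) (k ∸ b)) m m<c)

count : (List ℕ → ℕ) → ℕ → ℕ → List (List ℕ) → ℕ
count st n k = length ∘ filter (λ σ → (sum σ ≟ n) ×-dec (st σ ≟ k))

count-++ : ∀ st n k σs τs → count st n k (σs ++ τs) ≡ count st n k σs ℕ.+ count st n k τs
count-++ st n k σs τs =
  ≡.trans (≡.cong length (Lₚ.filter-++ _ σs τs)) (Lₚ.length-++ (filter (λ σ → (sum σ ≟ n) ×-dec (st σ ≟ k)) σs))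

private
  count-map-∷ : ∀ st n k c σs →
    count st n k (map (c ∷_) σs) ≡ length (filter (λ σ → (c ℕ.+ sum σ ≟ n) ×-dec (st (c ∷ σ) ≟ k)) σs)
  count-map-∷ st n k c σs = ≡.trans (≡.cong length (filter-map (λ σ → (sum σ ≟ n) ×-dec (st σ ≟ k)) (c ∷_) σs))
    (Lₚ.length-map (c ∷_) (filter (λ σ → (c ℕ.+ sum σ ≟ n) ×-dec (st (c ∷ σ) ≟ k)) σs))

count-∷ : ∀ st {n} k {c} σs → c ≤ n → count st n k (map (c ∷_) σs) ≡ count (st ∘ (c ∷_)) (n ∸ c) k σs
count-∷ st {n} k {c} σs c≤n = ≡.trans (count-map-∷ st n k c σs) (≡.cong length (Lₚ.filter-≐ _ _
  ( (λ (c+sum≡n , st≡k) → ≡.trans (≡.sym (ℕₚ.m+n∸m≡n c _)) (≡.cong (_∸ c) c+sum≡n) , st≡k)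
  , (λ (sum≡n∸c , st≡k) → ≡.trans (≡.cong (c ℕ.+_) sum≡n∸c) (ℕₚ.m+[n∸m]≡n c≤n) , st≡k))
  σs))

count-∷-> : ∀ st {n} k {c} σs → n < c → count st n k (map (c ∷_) σs) ≡ 0
count-∷-> st {n} k {c} σs n<c = ≡.trans (count-map-∷ st n k c σs) (≡.cong length (Lₚ.filter-none _
  (All.universal (λ σ (c+sum≡n , _) → ℕₚ.<⇒≱ n<c (≡.subst (c ≤_) c+sum≡n (ℕₚ.m≤m+n c (sum σ)))) σs)))

Cstat : List ℕ → (List ℕ → ℕ) → Series
Cstat A st n k m = + count st n k (words A m)

Cstat-cong : ∀ A {st st′} → (∀ σ → st σ ≡ st′ σ) → Cstat A st ≋ Cstat A st′
Cstat-cong A st≗st′ n k m = ≡.cong (+_ ∘ length) (Lₚ.filter-≐ _ _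
  ( (λ (sum≡n , st≡k) → sum≡n , ≡.trans (≡.sym (st≗st′ _)) st≡k)
  , (λ (sum≡n , st′≡k) → sum≡n , ≡.trans (st≗st′ _) st′≡k))
  (words A m))

Cstat-suc : ∀ A st → Cstat A (suc ∘ st) ≋ Y ⊛ Cstat A st
Cstat-suc A st n zero m = ≡.trans
  (≡.cong (+_ ∘ length) (Lₚ.filter-none _ (All.universal (λ _ ()) (words A m))))
  (≡.sym (mono-⊛-below 0 1 0 (Cstat A st) n 0 m (inj₂ (inj₁ z<s))))
Cstat-suc A st n (suc k) m = ≡.trans
  (≡.cong (+_ ∘ length) (Lₚ.filter-≐ _ _
    ( (λ (sum≡n , st≡k) → sum≡n , ℕₚ.suc-injective st≡k)
    , (λ (sum≡n , st≡k) → sum≡n , ≡.cong suc st≡k))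
    (words A m)))
  (≡.sym (mono-⊛ 0 1 0 (Cstat A st) n (suc k) m z≤n (s≤s z≤n) z≤n))

Cstat-empty : ∀ A st n k → Cstat A st n k 0 ≡ mono 0 (st []) 0 n k 0
Cstat-empty A st n k = ≡.trans (≡.cong +_ (length-filter-[x] (λ σ → (sum σ ≟ n) ×-dec (st σ ≟ k)) [])) (indicator n)
  where
  length-filter-[x] : ∀ {P : Pred (List ℕ) 0ℓ} (P? : Decidable P) x →
    length (filter P? (x ∷ [])) ≡ (if ⌊ P? x ⌋ then 1 else 0)
  length-filter-[x] P? x with P? x
  ... | yes _ = ≡.refl
  ... | no  _ = ≡.refl
  indicator : ∀ n → + (if ⌊ (0 ≟ n) ×-dec (st [] ≟ k) ⌋ then 1 else 0) ≡ mono 0 (st []) 0 n k 0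
  indicator (suc n) = ≡.refl
  indicator zero with k ≟ st [] | st [] ≟ k
  ... | yes _    | yes _     = ≡.refl
  ... | no  _    | no  _     = ≡.refl
  ... | yes k≡st | no  st≢k  = contradiction (≡.sym k≡st) st≢k
  ... | no  k≢st | yes st≡k  = contradiction (≡.sym st≡k) k≢st

count-∷-words : ∀ A st n k c m →
  + count st n k (map (c ∷_) (words A m)) ≡ (mono c 0 1 ⊛ Cstat A (st ∘ (c ∷_))) n k (suc m)
count-∷-words A st n k c m with c ℕ.≤? n
... | yes c≤n = ≡.trans (≡.cong +_ (count-∷ st k (words A m) c≤n))
  (≡.sym (mono-⊛ c 0 1 (Cstat A (st ∘ (c ∷_))) n k (suc m) c≤n z≤n (s≤s z≤n)))
... | no  c≰n = ≡.trans (≡.cong +_ (count-∷-> st k (words A m) (ℕₚ.≰⇒> c≰n)))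
  (≡.sym (mono-⊛-below c 0 1 (Cstat A (st ∘ (c ∷_))) n k (suc m) (inj₁ (ℕₚ.≰⇒> c≰n))))

private
  module Sₛ = FiniteSums seriesRing

Cstat-first-part : ∀ A st →
  Cstat A st ≋ mono 0 (st []) 0 ⊕ Sₛ.∑ₗ (map (λ c → mono c 0 1 ⊛ Cstat A (st ∘ (c ∷_))) A)
Cstat-first-part A st n k zero = begin
  Cstat A st n k 0                               ≡⟨ Cstat-empty A st n k ⟩
  mono 0 (st []) 0 n k 0                         ≡⟨ ℤₚ.+-identityʳ _ ⟨
  mono 0 (st []) 0 n k 0 ℤ.+ + 0                 ≡⟨ ≡.cong (λ s → mono 0 (st []) 0 n k 0 ℤ.+ s) (no-parts A) ⟨
  (mono 0 (st []) 0 ⊕ Sₛ.∑ₗ (map tail A)) n k 0  ∎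
  where
  open ≡.≡-Reasoning
  tail : ℕ → Series
  tail c = mono c 0 1 ⊛ Cstat A (st ∘ (c ∷_))
  no-parts : ∀ L → Sₛ.∑ₗ (map tail L) n k 0 ≡ + 0
  no-parts []      = ≡.refl
  no-parts (c ∷ L) =
    ≡.cong₂ ℤ._+_ (mono-⊛-below c 0 1 (Cstat A (st ∘ (c ∷_))) n k 0 (inj₂ (inj₂ z<s))) (no-parts L)
Cstat-first-part A st n k (suc m) = begin
  + count st n k (concatMap starting-with A)            ≡⟨ by-first-part A ⟩
  Sₛ.∑ₗ (map tail A) n k (suc m)                        ≡⟨ ℤₚ.+-identityˡ _ ⟨
  + 0 ℤ.+ Sₛ.∑ₗ (map tail A) n k (suc m)                ≡⟨ ≡.cong (λ s → s ℤ.+ Sₛ.∑ₗ (map tail A) n k (suc m)) no-empty ⟨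
  (mono 0 (st []) 0 ⊕ Sₛ.∑ₗ (map tail A)) n k (suc m)   ∎
  where
  open ≡.≡-Reasoning
  starting-with : ℕ → List (List ℕ)
  starting-with c = map (c ∷_) (words A m)
  tail : ℕ → Series
  tail c = mono c 0 1 ⊛ Cstat A (st ∘ (c ∷_))
  no-empty : mono 0 (st []) 0 n k (suc m) ≡ + 0
  no-empty with ⌊ n ≟ 0 ⌋ | ⌊ k ≟ st [] ⌋
  ... | true  | true  = ≡.refl
  ... | true  | false = ≡.refl
  ... | false | _     = ≡.refl
  by-first-part : ∀ L → + count st n k (concatMap starting-with L) ≡ Sₛ.∑ₗ (map tail L) n k (suc m)
  by-first-part []      = ≡.refl
  by-first-part (c ∷ L) = begin
    + count st n k (starting-with c ++ concatMap starting-with L)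
      ≡⟨ ≡.cong +_ (count-++ st n k (starting-with c) (concatMap starting-with L)) ⟩
    + (count st n k (starting-with c) ℕ.+ count st n k (concatMap starting-with L))
      ≡⟨ ℤₚ.pos-+ (count st n k (starting-with c)) (count st n k (concatMap starting-with L)) ⟩
    + count st n k (starting-with c) ℤ.+ + count st n k (concatMap starting-with L)
      ≡⟨ ≡.cong₂ ℤ._+_ (count-∷-words A st n k c m) (by-first-part L) ⟩
    Sₛ.∑ₗ (map tail (c ∷ L)) n k (suc m)
      ∎

peaks-∷-descent : ∀ {t c} τ → c ≤ t → peaks (t ∷ c ∷ τ) ≡ peaks (c ∷ τ)
peaks-∷-descent {t} {c} []      _   = ≡.refl
peaks-∷-descent {t} {c} (r ∷ ρ) c≤t with t <? c
... | yes t<c = contradiction c≤t (ℕₚ.<⇒≱ t<c)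
... | no  _   = ≡.refl

peaks-∷-ascent : ∀ {t c} τ → t < c → peaks (t ∷ c ∷ τ) ≡ peaks (0 ∷ c ∷ τ)
peaks-∷-ascent {t} {c} []      _   = ≡.refl
peaks-∷-ascent {t} {c} (r ∷ ρ) t<c with t <? c | 0 <? c
... | yes _ | yes _   = ≡.refl
... | no  ¬t<c | _    = contradiction t<c ¬t<c
... | yes _ | no ¬0<c = contradiction (ℕₚ.≤-<-trans z≤n t<c) ¬0<c

peaks-∷-peak : ∀ {t c e} ρ → t < c → e < c → peaks (t ∷ c ∷ e ∷ ρ) ≡ suc (peaks (e ∷ ρ))
peaks-∷-peak {t} {c} {e} ρ t<c e<c with t <? c | e <? c
... | yes _    | yes _    = ≡.cong suc (peaks-∷-descent ρ (ℕₚ.<⇒≤ e<c))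
... | no ¬t<c  | _        = contradiction t<c ¬t<c
... | yes _    | no ¬e<c  = contradiction e<c ¬e<c

peaks-∷-rise : ∀ {t c e} ρ → c ≤ e → peaks (t ∷ c ∷ e ∷ ρ) ≡ peaks (c ∷ e ∷ ρ)
peaks-∷-rise {t} {c} {e} ρ c≤e with t <? c | e <? c
... | yes _ | no _    = ≡.refl
... | no  _ | _       = ≡.refl
... | yes _ | yes e<c = contradiction c≤e (ℕₚ.<⇒≱ e<c)

cfrac-fraction : ∀ c cs → cfrac c cs ≡ ContinuedFractions.fraction seriesRing c cs
cfrac-fraction c []       = ≡.refl
cfrac-fraction c (x ∷ xs) rewrite ≡.sym (cfrac-fraction x xs) = ≡.refl

module PeakSeries (a : ℕ → ℕ) (d : ℕ) (increasing : ∀ i → 1 ≤ i → i < d → a i < a (suc i)) where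

  open CommutativeRing seriesRing hiding (zero)
  open FiniteSums seriesRing
  open PeakSystems seriesRing using (IsPeakSystem)
  open ContinuedFractions.Convergents seriesRing using (quotients)

  α : ℕ → ℕ
  α i = a (suc i)

  α-< : ∀ {i j} → i < j → j < d → α i < α j
  α-< {i} {suc j} i<1+j 1+j<d with ℕₚ.m≤n⇒m<n∨m≡n (ℕₚ.≤-pred i<1+j)
  ... | inj₁ i<j  = ℕₚ.<-trans (α-< i<j (ℕₚ.<-trans (ℕₚ.n<1+n j) 1+j<d)) (increasing (suc j) (s≤s z≤n) 1+j<d)
  ... | inj₂ ≡.refl = increasing (suc i) (s≤s z≤n) 1+j<d

  α-≤ : ∀ {i j} → i ≤ j → j < d → α i ≤ α j
  α-≤ i≤j j<d with ℕₚ.m≤n⇒m<n∨m≡n i≤j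
  ... | inj₁ i<j  = ℕₚ.<⇒≤ (α-< i<j j<d)
  ... | inj₂ ≡.refl = ℕₚ.≤-refl

  B : ℕ → Series
  B i = b a (suc i)

  u : Series
  u = 1# - Y

  V W : ℕ → Series
  V j = Cstat (partList a d) (λ σ → peaks (α j ∷ σ))
  W j = Cstat (partList a d) (λ σ → peaks (0 ∷ α j ∷ σ))

  first-part : ∀ st →
    Cstat (partList a d) st ≈ mono 0 (st []) 0 + ∑[ i < d ] (B i * Cstat (partList a d) (λ σ → st (α i ∷ σ)))
  first-part st = trans (Cstat-first-part (partList a d) st) (+-congˡ {mono 0 (st []) 0} (reflexive parts-sum))
    where
    tail : ℕ → Series
    tail c = mono c 0 1 * Cstat (partList a d) (st ∘ (c ∷_))
    parts-sum : ∑ₗ (map tail (partList a d)) ≡ ∑< d (tail ∘ α)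
    parts-sum = ≡.trans (≡.cong (∑ₗ ∘ map tail) (Lₚ.map-applyUpTo id α d))
      (≡.trans (≡.cong ∑ₗ (Lₚ.map-applyUpTo α tail d)) (∑ₗ-applyUpTo (tail ∘ α) d))

  X G : ℕ → ℕ → Series
  X j i = Cstat (partList a d) (λ σ → peaks (α j ∷ α i ∷ σ))
  G j i = Cstat (partList a d) (λ σ → peaks (0 ∷ α j ∷ α i ∷ σ))

  peakSystem : IsPeakSystem d B V W X G Y (Cpeak (partList a d))
  peakSystem = record
    { C-first-part = first-part peaks
    ; V-first-part = λ j → first-part (λ σ → peaks (α j ∷ σ))
    ; W-first-part = λ j → first-part (λ σ → peaks (0 ∷ α j ∷ σ))
    ; X-descent    = λ i≤j j<d → Cstat-cong (partList a d) (λ σ → peaks-∷-descent σ (α-≤ i≤j j<d))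
    ; X-ascent     = λ j<i i<d → Cstat-cong (partList a d) (λ σ → peaks-∷-ascent σ (α-< j<i i<d))
    ; G-peak       = λ {i} i<j j<d → trans
        (Cstat-cong (partList a d) (λ σ → peaks-∷-peak σ (ℕₚ.≤-<-trans z≤n (α-< i<j j<d)) (α-< i<j j<d)))
        (Cstat-suc (partList a d) (λ σ → peaks (α i ∷ σ)))
    ; G-rise       = λ j≤i i<d → Cstat-cong (partList a d) (λ σ → peaks-∷-rise σ (α-≤ j≤i i<d))
    }

  cf-tail-quotients : ∀ e → d ≡ suc (suc e) → cf-tail a d ≡ B e ∷ quotients B V u e
  cf-tail-quotients e ≡.refl =
    ≡.trans (≡.cong (λ xs → concat xs ++ b a 1 ∷ []) (Lₚ.map-applyUpTo id quotient-pair e)) (unfold e)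
    where
    quotient-pair : ℕ → List Series
    quotient-pair k = b a (suc e ∸ k) ∷ b a (suc e ∸ k) ⊛ (𝟙 ⊝ Y) ∷ []
    unfold : ∀ k → concat (applyUpTo (λ i → b a (suc k ∸ i) ∷ b a (suc k ∸ i) ⊛ (𝟙 ⊝ Y) ∷ []) k) ++ b a 1 ∷ []
                   ≡ B k ∷ quotients B V u k
    unfold zero    = ≡.refl
    unfold (suc k) = ≡.cong (λ xs → B (suc k) ∷ B (suc k) * u ∷ xs) (unfold k)

lemma2 : (d : ℕ) (a : ℕ → ℕ) → 2 ≤ d → 0 < a 1 →
    (∀ i → 1 ≤ i → i < d → a i < a (suc i)) →
    let P = proj₁ (cfrac (cf-head a d) (cf-tail a d))
        Q = proj₂ (cfrac (cf-head a d) (cf-tail a d))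
    in ((𝟙 ⊝ b a d) ⊛ P ⊝ Q) ⊛ Cpeak (partList a d) ≋ P
-- The hypothesis 0 < a 1 is unused: only the increase of the parts matters, and the z-grading
-- already makes every coefficient a finite count.
lemma2 (suc (suc e)) a (s≤s (s≤s z≤n)) _ increasing =
  ≡.subst (λ PQ → ((𝟙 ⊝ b a d) ⊛ proj₁ PQ ⊝ proj₂ PQ) ⊛ Cpeak (partList a d) ≋ proj₁ PQ) (≡.sym cfrac≡fraction)
    (fraction-identity e (Cpeak (partList a d))
      (λ i i<1+e → V-step peakSystem i (s≤s i<1+e)) (C≈V peakSystem ≡.refl) (IsPeakSystem.C-first-part peakSystem))
  where
  d = suc (suc e)
  open PeakSeries a d increasing
  open ContinuedFractions seriesRing
  open Convergents B V u
  open PeakSystems seriesRing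
  cfrac≡fraction : cfrac (cf-head a d) (cf-tail a d) ≡ fraction (B (suc e) ⊛ u) (B e ∷ quotients e)
  cfrac≡fraction = ≡.trans (≡.cong (cfrac (cf-head a d)) (cf-tail-quotients e ≡.refl)) (cfrac-fraction (B (suc e) ⊛ u) (B e ∷ quotients e))
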